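{- Consider a Max-$k$-Coverage instance $(U,\mathcal M,k)$, let $\mathcal S=\{S_1,\dots,S_k\}$ be the output of the greedy algorithm, and let $\mathcal S^\ast=\{S_1^\ast,\dots,S_k^\ast\}$ be an optimal solution. Let $\varepsilon>0$ (possibly depending on $k$). If there exists $S_i^\ast\in\mathcal S^\ast$ with $|S_i^\ast|<(\frac1k-\varepsilon)\mathrm{val}(\mathcal S^\ast)$, then $$\mathrm{val}(\mathcal S)\ge\Big(1-\big(1-\tfrac1k\big)^k+\tfrac{\varepsilon}{8k}\Big)\mathrm{val}(\mathcal S^\ast).$$
   Context: A Max-$k$-Coverage instance consists of a finite universe $U$, a collection $\mathcal M$ of subsets of $U$ with $|\mathcal M|\ge k$, and a positive integer $k$. For a collection $\mathcal C\subseteq\mathcal M$, $\mathrm{val}(\mathcal C)=\big|\bigcup_{T\in\mathcal C}T\big|$. An optimal solution is a collection of $k$ members of $\mathcal M$ maximizing $\mathrm{val}$. The greedy algorithm selects $k$ members of $\mathcal M$ one at a time, each time choosing a member maximizing the increase of $\mathrm{val}$ of the collection selected so far.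
   Formalization: The parameter ε ranges over the positive rationals. -}

module Defs where

open import Data.Nat using (ℕ; zero; suc; NonZero)
open import Data.Integer using (+_)
open import Data.Fin using (Fin)
open import Data.Fin.Subset using (Subset; _∪_; ⊥; ∣_∣)
open import Data.List using (List; []; _∷_; _++_; map; foldr; length; [_])
open import Data.List.Membership.Propositional using (_∉_)
open import Data.List.Relation.Unary.Unique.Propositional using (Unique)
open import Data.Nat using (_≤_)
open import Data.Product using (_×_)
open import Relation.Binary.PropositionalEquality using (_≡_)
open import Data.Rational using (ℚ; 1ℚ; _*_; _/_)

-- A Max-k-Coverage instance: universe U = Fin n, the collection M is
-- given as an indexed family of m subsets of U (members are the indices).
Family : ℕ → ℕ → Set
Family n m = Fin m → Subset n

⋃ : ∀ {n} → List (Subset n) → Subset n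
⋃ = foldr _∪_ ⊥

val : ∀ {n m} → Family n m → List (Fin m) → ℕ
val F C = ∣ ⋃ (map F C) ∣

IsCollection : ∀ {m} → ℕ → List (Fin m) → Set
IsCollection k C = Unique C × length C ≡ k

IsOptimal : ∀ {n m} → Family n m → ℕ → List (Fin m) → Set
IsOptimal {m = m} F k O =
  IsCollection k O × (∀ (C : List (Fin m)) → IsCollection k C → val F C ≤ val F O)

data GreedyRun {n m} (F : Family n m) : List (Fin m) → Set where
  start : GreedyRun F []
  step  : ∀ {prev} {t : Fin m}
        → GreedyRun F prev
        → t ∉ prev
        → (∀ (u : Fin m) → u ∉ prev → val F (prev ++ [ u ]) ≤ val F (prev ++ [ t ]))
        → GreedyRun F (prev ++ [ t ])

IsGreedyOutput : ∀ {n m} → Family n m → ℕ → List (Fin m) → Set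
IsGreedyOutput F k S = GreedyRun F S × IsCollection k S

ℕtoℚ : ℕ → ℚ
ℕtoℚ a = + a / 1

_^ℚ_ : ℚ → ℕ → ℚ
q ^ℚ zero  = 1ℚ
q ^ℚ suc e = q * (q ^ℚ e)

module Submission where

open import Defs
open import Data.Nat as ℕ using (ℕ; zero; suc; NonZero; z≤n; ⌊_/2⌋; ⌈_/2⌉)
import Data.Nat.Properties as ℕ
open import Data.Integer as ℤ using (+_)
import Data.Integer.Properties as ℤ
open import Data.Fin using (Fin; _≟_)
open import Data.Fin.Subset using (Subset; _∪_; _∩_; ⊥; ∣_∣; _⊆_; inside; outside)
open import Data.Fin.Subset.Properties
  using (∪-identityˡ; ∪-identityʳ; ∪-assoc; p⊆p∪q; q⊆p∪q; x∈p∪q⁻; x∈p∩q⁺; ⊆-trans; p⊆q⇒∣p∣≤∣q∣; ∣p∣≤∣p∪q∣; ∣q∣≤∣p∪q∣; ∣⊥∣≡0)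
open import Data.Vec using ([]; _∷_)
open import Data.List using (List; []; _∷_; _++_; map; length; [_])
open import Data.List.Properties using (map-++; length-++)
open import Data.List.Relation.Unary.Any using (here; there; any?)
open import Data.List.Membership.Propositional using (_∈_; _∉_)
open import Data.Rational using (ℚ; mkℚ; 0ℚ; 1ℚ; _+_; _*_; _-_; -_; nonNegative; _/_; _≤_; _<_; toℚᵘ)
import Data.Rational.Properties as ℚ
import Data.Rational.Unnormalised as ℚᵘ
import Data.Rational.Unnormalised.Properties as ℚᵘ
open import Data.Rational.Solver using (module +-*-Solver)
open +-*-Solver using (solve; con; _:+_; _:*_; _:-_; _:=_)
import Data.Nat.Coprimality as Coprime
open import Data.Product using (_×_; _,_; ∃-syntax)
open import Data.Sum using (inj₁; inj₂)
open import Data.Empty using (⊥-elim)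
open import Relation.Nullary using (yes; no)
open import Relation.Binary.PropositionalEquality
  using (_≡_; refl; sym; trans; cong; cong₂; subst; subst₂)

-- Write O for val(S*) and gⱼ for the value of the first j greedy sets. Coverage is
-- submodular, so the k sets of S* add at most k times the best marginal gain to
-- the current union; this gives the usual recurrence O - gⱼ₊₁ ≤ (1 - 1/k)(O - gⱼ).
-- Since g₁ bounds every member, O ≤ |Sᵢ*| + (k - 1) g₁, and a small Sᵢ* sharpens
-- the first step to O - g₁ ≤ (1 - 1/k) O - (ε/k) O. The extra ε/k · O is then
-- damped by the remaining k - 1 steps only down to (1 - 1/k)^(k-1) ≥ 1/4 ≥ 1/8
-- of itself, by Bernoulli's inequality applied to two halves of the exponent.

∣p∪q∣+∣p∩q∣≡∣p∣+∣q∣ : ∀ {n} (p q : Subset n) → ∣ p ∪ q ∣ ℕ.+ ∣ p ∩ q ∣ ≡ ∣ p ∣ ℕ.+ ∣ q ∣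
∣p∪q∣+∣p∩q∣≡∣p∣+∣q∣ []            []            = refl
∣p∪q∣+∣p∩q∣≡∣p∣+∣q∣ (inside  ∷ p) (inside  ∷ q) = cong suc (trans (ℕ.+-suc _ _)
  (trans (cong suc (∣p∪q∣+∣p∩q∣≡∣p∣+∣q∣ p q)) (sym (ℕ.+-suc _ _))))
∣p∪q∣+∣p∩q∣≡∣p∣+∣q∣ (inside  ∷ p) (outside ∷ q) = cong suc (∣p∪q∣+∣p∩q∣≡∣p∣+∣q∣ p q)
∣p∪q∣+∣p∩q∣≡∣p∣+∣q∣ (outside ∷ p) (inside  ∷ q) =
  trans (cong suc (∣p∪q∣+∣p∩q∣≡∣p∣+∣q∣ p q)) (sym (ℕ.+-suc _ _))
∣p∪q∣+∣p∩q∣≡∣p∣+∣q∣ (outside ∷ p) (outside ∷ q) = ∣p∪q∣+∣p∩q∣≡∣p∣+∣q∣ p q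

∣p∪q∣≤∣p∣+∣q∣ : ∀ {n} (p q : Subset n) → ∣ p ∪ q ∣ ℕ.≤ ∣ p ∣ ℕ.+ ∣ q ∣
∣p∪q∣≤∣p∣+∣q∣ p q = ℕ.≤-trans (ℕ.m≤m+n _ _) (ℕ.≤-reflexive (∣p∪q∣+∣p∩q∣≡∣p∣+∣q∣ p q))

∣p∪[q∪r]∣+∣p∣≤∣p∪q∣+∣p∪r∣ : ∀ {n} (p q r : Subset n) →
                           ∣ p ∪ (q ∪ r) ∣ ℕ.+ ∣ p ∣ ℕ.≤ ∣ p ∪ q ∣ ℕ.+ ∣ p ∪ r ∣
∣p∪[q∪r]∣+∣p∣≤∣p∪q∣+∣p∪r∣ p q r = begin
  ∣ p ∪ (q ∪ r) ∣ ℕ.+ ∣ p ∣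
    ≤⟨ ℕ.+-mono-≤ (p⊆q⇒∣p∣≤∣q∣ p∪[q∪r]⊆[p∪q]∪[p∪r]) (p⊆q⇒∣p∣≤∣q∣ p⊆[p∪q]∩[p∪r]) ⟩
  ∣ (p ∪ q) ∪ (p ∪ r) ∣ ℕ.+ ∣ (p ∪ q) ∩ (p ∪ r) ∣
    ≡⟨ ∣p∪q∣+∣p∩q∣≡∣p∣+∣q∣ (p ∪ q) (p ∪ r) ⟩
  ∣ p ∪ q ∣ ℕ.+ ∣ p ∪ r ∣ ∎
  where
  open ℕ.≤-Reasoning
  p∪[q∪r]⊆[p∪q]∪[p∪r] : p ∪ (q ∪ r) ⊆ (p ∪ q) ∪ (p ∪ r)
  p∪[q∪r]⊆[p∪q]∪[p∪r] x∈ with x∈p∪q⁻ p (q ∪ r) x∈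
  ... | inj₁ x∈p = p⊆p∪q (p ∪ r) (p⊆p∪q q x∈p)
  ... | inj₂ x∈q∪r with x∈p∪q⁻ q r x∈q∪r
  ...   | inj₁ x∈q = p⊆p∪q (p ∪ r) (q⊆p∪q p q x∈q)
  ...   | inj₂ x∈r = q⊆p∪q (p ∪ q) (p ∪ r) (q⊆p∪q p r x∈r)
  p⊆[p∪q]∩[p∪r] : p ⊆ (p ∪ q) ∩ (p ∪ r)
  p⊆[p∪q]∩[p∪r] x∈p = x∈p∩q⁺ (p⊆p∪q q x∈p , p⊆p∪q r x∈p)

⋃-++ : ∀ {n} (xs ys : List (Subset n)) → ⋃ (xs ++ ys) ≡ ⋃ xs ∪ ⋃ ys
⋃-++ []       ys = sym (∪-identityˡ _)
⋃-++ (x ∷ xs) ys = trans (cong (x ∪_) (⋃-++ xs ys)) (sym (∪-assoc x _ _))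

module _ {n m} (F : Family n m) where

  val-∷ʳ : ∀ C u → val F (C ++ [ u ]) ≡ ∣ ⋃ (map F C) ∪ F u ∣
  val-∷ʳ C u = cong ∣_∣ (begin
    ⋃ (map F (C ++ [ u ]))        ≡⟨ cong ⋃ (map-++ F C [ u ]) ⟩
    ⋃ (map F C ++ [ F u ])        ≡⟨ ⋃-++ (map F C) [ F u ] ⟩
    ⋃ (map F C) ∪ (F u ∪ ⊥)       ≡⟨ cong (⋃ (map F C) ∪_) (∪-identityʳ (F u)) ⟩
    ⋃ (map F C) ∪ F u             ∎)
    where open Relation.Binary.PropositionalEquality.≡-Reasoning

  ∈⇒⊆⋃ : ∀ {u C} → u ∈ C → F u ⊆ ⋃ (map F C)
  ∈⇒⊆⋃ {C = v ∷ C} (here refl) = p⊆p∪q _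
  ∈⇒⊆⋃ {C = v ∷ C} (there u∈C) = ⊆-trans (∈⇒⊆⋃ u∈C) (q⊆p∪q (F v) _)

  val≤length*max : ∀ {g} → (∀ u → ∣ F u ∣ ℕ.≤ g) → ∀ C → val F C ℕ.≤ length C ℕ.* g
  val≤length*max bounded []      = ℕ.≤-reflexive (∣⊥∣≡0 n)
  val≤length*max bounded (u ∷ C) =
    ℕ.≤-trans (∣p∪q∣≤∣p∣+∣q∣ (F u) _) (ℕ.+-mono-≤ (bounded u) (val≤length*max bounded C))

  val+max≤∣F∣+length*max : ∀ {g} → (∀ u → ∣ F u ∣ ℕ.≤ g) → ∀ {i C} → i ∈ C →
                          val F C ℕ.+ g ℕ.≤ ∣ F i ∣ ℕ.+ length C ℕ.* g
  val+max≤∣F∣+length*max {g} bounded {i} (here {xs = C} refl) = begin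
    ∣ F i ∪ ⋃ (map F C) ∣ ℕ.+ g           ≤⟨ ℕ.+-monoˡ-≤ g (∣p∪q∣≤∣p∣+∣q∣ (F i) _) ⟩
    (∣ F i ∣ ℕ.+ val F C) ℕ.+ g            ≤⟨ ℕ.+-monoˡ-≤ g (ℕ.+-monoʳ-≤ ∣ F i ∣ (val≤length*max bounded C)) ⟩
    (∣ F i ∣ ℕ.+ length C ℕ.* g) ℕ.+ g     ≡⟨ ℕ.+-assoc ∣ F i ∣ _ g ⟩
    ∣ F i ∣ ℕ.+ (length C ℕ.* g ℕ.+ g)     ≡⟨ cong (∣ F i ∣ ℕ.+_) (ℕ.+-comm _ g) ⟩
    ∣ F i ∣ ℕ.+ length (i ∷ C) ℕ.* g       ∎
    where open ℕ.≤-Reasoning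
  val+max≤∣F∣+length*max {g} bounded {i} (there {x = v} {xs = C} i∈C) = begin
    ∣ F v ∪ ⋃ (map F C) ∣ ℕ.+ g            ≤⟨ ℕ.+-monoˡ-≤ g (∣p∪q∣≤∣p∣+∣q∣ (F v) _) ⟩
    (∣ F v ∣ ℕ.+ val F C) ℕ.+ g             ≡⟨ ℕ.+-assoc ∣ F v ∣ _ g ⟩
    ∣ F v ∣ ℕ.+ (val F C ℕ.+ g)             ≤⟨ ℕ.+-mono-≤ (bounded v) (val+max≤∣F∣+length*max bounded i∈C) ⟩
    g ℕ.+ (∣ F i ∣ ℕ.+ length C ℕ.* g)      ≡⟨ ℕ.+-comm g _ ⟩
    (∣ F i ∣ ℕ.+ length C ℕ.* g) ℕ.+ g      ≡⟨ ℕ.+-assoc ∣ F i ∣ _ g ⟩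
    ∣ F i ∣ ℕ.+ (length C ℕ.* g ℕ.+ g)      ≡⟨ cong (∣ F i ∣ ℕ.+_) (ℕ.+-comm _ g) ⟩
    ∣ F i ∣ ℕ.+ length (v ∷ C) ℕ.* g        ∎
    where open ℕ.≤-Reasoning

  gain≤length*max-gain : ∀ P {g} → (∀ u → ∣ P ∪ F u ∣ ℕ.≤ g) → ∀ C →
                         ∣ P ∪ ⋃ (map F C) ∣ ℕ.+ length C ℕ.* ∣ P ∣ ℕ.≤ ∣ P ∣ ℕ.+ length C ℕ.* g
  gain≤length*max-gain P {g} bounded [] = begin
    ∣ P ∪ ⊥ ∣ ℕ.+ 0   ≡⟨ cong (λ A → ∣ A ∣ ℕ.+ 0) (∪-identityʳ P) ⟩
    ∣ P ∣ ℕ.+ 0       ∎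
    where open ℕ.≤-Reasoning
  gain≤length*max-gain P {g} bounded (u ∷ C) = begin
    ∣ P ∪ (F u ∪ R) ∣ ℕ.+ (∣ P ∣ ℕ.+ L ℕ.* ∣ P ∣)    ≡⟨ ℕ.+-assoc ∣ P ∪ (F u ∪ R) ∣ ∣ P ∣ (L ℕ.* ∣ P ∣) ⟨
    (∣ P ∪ (F u ∪ R) ∣ ℕ.+ ∣ P ∣) ℕ.+ L ℕ.* ∣ P ∣    ≤⟨ ℕ.+-monoˡ-≤ (L ℕ.* ∣ P ∣) (∣p∪[q∪r]∣+∣p∣≤∣p∪q∣+∣p∪r∣ P (F u) R) ⟩
    (∣ P ∪ F u ∣ ℕ.+ ∣ P ∪ R ∣) ℕ.+ L ℕ.* ∣ P ∣      ≤⟨ ℕ.+-monoˡ-≤ (L ℕ.* ∣ P ∣) (ℕ.+-monoˡ-≤ ∣ P ∪ R ∣ (bounded u)) ⟩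
    (g ℕ.+ ∣ P ∪ R ∣) ℕ.+ L ℕ.* ∣ P ∣                ≡⟨ ℕ.+-assoc g ∣ P ∪ R ∣ (L ℕ.* ∣ P ∣) ⟩
    g ℕ.+ (∣ P ∪ R ∣ ℕ.+ L ℕ.* ∣ P ∣)                ≤⟨ ℕ.+-monoʳ-≤ g (gain≤length*max-gain P bounded C) ⟩
    g ℕ.+ (∣ P ∣ ℕ.+ L ℕ.* g)                        ≡⟨ ℕ.+-assoc g ∣ P ∣ (L ℕ.* g) ⟨
    (g ℕ.+ ∣ P ∣) ℕ.+ L ℕ.* g                        ≡⟨ cong (ℕ._+ L ℕ.* g) (ℕ.+-comm g ∣ P ∣) ⟩
    (∣ P ∣ ℕ.+ g) ℕ.+ L ℕ.* g                        ≡⟨ ℕ.+-assoc ∣ P ∣ g (L ℕ.* g) ⟩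
    ∣ P ∣ ℕ.+ (g ℕ.+ L ℕ.* g)                        ∎
    where
    open ℕ.≤-Reasoning
    R : Subset n
    R = ⋃ (map F C)
    L : ℕ
    L = length C

  IsGreedyChoice : List (Fin m) → Fin m → Set
  IsGreedyChoice C t = ∀ u → u ∉ C → val F (C ++ [ u ]) ℕ.≤ val F (C ++ [ t ])

  -- Members already in C add nothing, so the greedy choice beats them too.
  greedy-choice-maximal : ∀ {C t} → IsGreedyChoice C t → ∀ u → ∣ ⋃ (map F C) ∪ F u ∣ ℕ.≤ val F (C ++ [ t ])
  greedy-choice-maximal {C} {t} greedy u with any? (u ≟_) C
  ... | yes u∈C = ℕ.≤-trans (p⊆q⇒∣p∣≤∣q∣ ⋃C∪Fu⊆⋃C)
                    (subst (∣ ⋃ (map F C) ∣ ℕ.≤_) (sym (val-∷ʳ C t)) (∣p∣≤∣p∪q∣ (⋃ (map F C)) (F t)))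
    where
    ⋃C∪Fu⊆⋃C : ⋃ (map F C) ∪ F u ⊆ ⋃ (map F C)
    ⋃C∪Fu⊆⋃C x∈ with x∈p∪q⁻ (⋃ (map F C)) (F u) x∈
    ... | inj₁ x∈⋃C = x∈⋃C
    ... | inj₂ x∈Fu = ∈⇒⊆⋃ u∈C x∈Fu
  ... | no  u∉C = subst (ℕ._≤ val F (C ++ [ t ])) (val-∷ʳ C u) (greedy u u∉C)

  greedy-step-bound : ∀ {C t} → IsGreedyChoice C t → ∀ Os →
                      val F Os ℕ.+ length Os ℕ.* val F C ℕ.≤ val F C ℕ.+ length Os ℕ.* val F (C ++ [ t ])
  greedy-step-bound {C} greedy Os =
    ℕ.≤-trans (ℕ.+-monoˡ-≤ _ (∣q∣≤∣p∪q∣ (⋃ (map F C)) (⋃ (map F Os))))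
              (gain≤length*max-gain (⋃ (map F C)) (greedy-choice-maximal greedy) Os)

  greedy-first-choice-maximal : ∀ {L t ts} → GreedyRun F L → L ≡ t ∷ ts → ∀ u → ∣ F u ∣ ℕ.≤ val F [ t ]
  greedy-first-choice-maximal (step {[]} {t} _ _ greedy) refl u =
    subst (ℕ._≤ val F [ t ]) (cong ∣_∣ (∪-identityʳ (F u))) (greedy u λ ())
  greedy-first-choice-maximal (step {_ ∷ _} run _ _) refl = greedy-first-choice-maximal run refl

toℚᵘ-ℕtoℚ : ∀ a → toℚᵘ (ℕtoℚ a) ℚᵘ.≃ ℚᵘ.mkℚᵘ (+ a) 0
toℚᵘ-ℕtoℚ a = ℚ.toℚᵘ-fromℚᵘ (ℚᵘ.mkℚᵘ (+ a) 0)

ℕtoℚ-+ : ∀ a b → ℕtoℚ (a ℕ.+ b) ≡ ℕtoℚ a + ℕtoℚ b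
ℕtoℚ-+ a b = ℚ.toℚᵘ-injective (begin
  toℚᵘ (ℕtoℚ (a ℕ.+ b))                  ≈⟨ toℚᵘ-ℕtoℚ (a ℕ.+ b) ⟩
  ℚᵘ.mkℚᵘ (+ (a ℕ.+ b)) 0                ≈⟨ ℚᵘ.*≡* (cong (ℤ._* + 1) (trans (ℤ.pos-+ a b)
                                               (sym (cong₂ ℤ._+_ (ℤ.*-identityʳ (+ a)) (ℤ.*-identityʳ (+ b)))))) ⟩
  ℚᵘ.mkℚᵘ (+ a) 0 ℚᵘ.+ ℚᵘ.mkℚᵘ (+ b) 0   ≈⟨ ℚᵘ.+-cong (toℚᵘ-ℕtoℚ a) (toℚᵘ-ℕtoℚ b) ⟨
  toℚᵘ (ℕtoℚ a) ℚᵘ.+ toℚᵘ (ℕtoℚ b)       ≈⟨ ℚ.toℚᵘ-homo-+ (ℕtoℚ a) (ℕtoℚ b) ⟨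
  toℚᵘ (ℕtoℚ a + ℕtoℚ b)                 ∎)
  where open import Relation.Binary.Reasoning.Setoid ℚᵘ.≃-setoid

ℕtoℚ-* : ∀ a b → ℕtoℚ (a ℕ.* b) ≡ ℕtoℚ a * ℕtoℚ b
ℕtoℚ-* a b = ℚ.toℚᵘ-injective (begin
  toℚᵘ (ℕtoℚ (a ℕ.* b))                  ≈⟨ toℚᵘ-ℕtoℚ (a ℕ.* b) ⟩
  ℚᵘ.mkℚᵘ (+ (a ℕ.* b)) 0                ≈⟨ ℚᵘ.*≡* (cong (ℤ._* + 1) (ℤ.pos-* a b)) ⟩
  ℚᵘ.mkℚᵘ (+ a) 0 ℚᵘ.* ℚᵘ.mkℚᵘ (+ b) 0   ≈⟨ ℚᵘ.*-cong (toℚᵘ-ℕtoℚ a) (toℚᵘ-ℕtoℚ b) ⟨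
  toℚᵘ (ℕtoℚ a) ℚᵘ.* toℚᵘ (ℕtoℚ b)       ≈⟨ ℚ.toℚᵘ-homo-* (ℕtoℚ a) (ℕtoℚ b) ⟨
  toℚᵘ (ℕtoℚ a * ℕtoℚ b)                 ∎)
  where open import Relation.Binary.Reasoning.Setoid ℚᵘ.≃-setoid

ℕtoℚ-mono-≤ : ∀ {a b} → a ℕ.≤ b → ℕtoℚ a ≤ ℕtoℚ b
ℕtoℚ-mono-≤ {a} {b} a≤b = ℚ.toℚᵘ-cancel-≤
  (ℚᵘ.≤-respʳ-≃ (ℚᵘ.≃-sym (toℚᵘ-ℕtoℚ b)) (ℚᵘ.≤-respˡ-≃ (ℚᵘ.≃-sym (toℚᵘ-ℕtoℚ a))
    (ℚᵘ.*≤* (ℤ.*-monoʳ-≤-nonNeg (+ 1) (ℤ.+≤+ a≤b)))))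

ℕtoℚ-mono-≤-+* : ∀ a b c d e → a ℕ.+ b ℕ.* c ℕ.≤ d ℕ.+ b ℕ.* e →
                 ℕtoℚ a + ℕtoℚ b * ℕtoℚ c ≤ ℕtoℚ d + ℕtoℚ b * ℕtoℚ e
ℕtoℚ-mono-≤-+* a b c d e ineq = subst₂ _≤_ (ℕtoℚ-+-* a c) (ℕtoℚ-+-* d e) (ℕtoℚ-mono-≤ ineq)
  where
  ℕtoℚ-+-* : ∀ x y → ℕtoℚ (x ℕ.+ b ℕ.* y) ≡ ℕtoℚ x + ℕtoℚ b * ℕtoℚ y
  ℕtoℚ-+-* x y = trans (ℕtoℚ-+ x (b ℕ.* y)) (cong (λ z → ℕtoℚ x + z) (ℕtoℚ-* b y))

ℕtoℚ-*-inverseʳ : ∀ k .{{_ : NonZero k}} → ℕtoℚ k * (+ 1 / k) ≡ 1ℚ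
ℕtoℚ-*-inverseʳ (suc k) =
  trans (cong₂ _*_ (ℚ.↥p/↧p≡p k/1) (ℚ.↥p/↧p≡p (mkℚ (+ 1) k (Coprime.1-coprimeTo (suc k)))))
        (ℚ.*-inverseʳ k/1)
  where
  k/1 : ℚ
  k/1 = mkℚ (+ suc k) 0 (Coprime.sym (Coprime.1-coprimeTo (suc k)))

-- An inequality p ≤ q is proved by writing q - p, via a ring identity, as a
-- sum of products of nonnegative quantities (slacks of hypotheses and signs).
≤-by-nonNeg-difference : ∀ {p q s} → q - p ≡ s → 0ℚ ≤ s → p ≤ q
≤-by-nonNeg-difference {p} {q} q-p≡s 0≤s =
  subst₂ _≤_ (ℚ.+-identityˡ p) (solve 2 (λ p q → (q :- p) :+ p := q) refl p q)
         (ℚ.+-monoˡ-≤ p (subst (0ℚ ≤_) (sym q-p≡s) 0≤s))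

p≤q⇒0≤q-p : ∀ {p q} → p ≤ q → 0ℚ ≤ q - p
p≤q⇒0≤q-p {p} {q} p≤q = subst (_≤ q - p) (ℚ.+-inverseʳ p) (ℚ.+-monoˡ-≤ (- p) p≤q)

+-pres-0≤ : ∀ {p q} → 0ℚ ≤ p → 0ℚ ≤ q → 0ℚ ≤ p + q
+-pres-0≤ = ℚ.+-mono-≤

*-pres-0≤ : ∀ {p q} → 0ℚ ≤ p → 0ℚ ≤ q → 0ℚ ≤ p * q
*-pres-0≤ {p} {q} 0≤p 0≤q = ℚ.nonNegative⁻¹ (p * q)
  {{ℚ.nonNeg*nonNeg⇒nonNeg p {{nonNegative 0≤p}} q {{nonNegative 0≤q}}}}

^ℚ-+ : ∀ (x : ℚ) a b → x ^ℚ (a ℕ.+ b) ≡ x ^ℚ a * x ^ℚ b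
^ℚ-+ x zero    b = sym (ℚ.*-identityˡ _)
^ℚ-+ x (suc a) b = trans (cong (x *_) (^ℚ-+ x a b)) (sym (ℚ.*-assoc x _ _))

bernoulli : ∀ {r} → 0ℚ ≤ r → r ≤ 1ℚ → ∀ a → 1ℚ - ℕtoℚ a * r ≤ (1ℚ - r) ^ℚ a
bernoulli {r} 0≤r r≤1 zero = ℚ.≤-reflexive (solve 1 (λ r → con 1ℚ :- con 0ℚ :* r := con 1ℚ) refl r)
bernoulli {r} 0≤r r≤1 (suc a) = ≤-by-nonNeg-difference identity
  (+-pres-0≤ (*-pres-0≤ (p≤q⇒0≤q-p r≤1) (p≤q⇒0≤q-p (bernoulli 0≤r r≤1 a)))
             (*-pres-0≤ (*-pres-0≤ (ℕtoℚ-mono-≤ {b = a} z≤n) 0≤r) 0≤r))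
  where
  A : ℚ
  A = ℕtoℚ a
  identity : (1ℚ - r) ^ℚ suc a - (1ℚ - ℕtoℚ (suc a) * r)
           ≡ (1ℚ - r) * ((1ℚ - r) ^ℚ a - (1ℚ - A * r)) + A * r * r
  identity = trans (cong (λ s → (1ℚ - r) ^ℚ suc a - (1ℚ - s * r)) (ℕtoℚ-+ 1 a))
    (solve 3 (λ r A P → (con 1ℚ :- r) :* P :- (con 1ℚ :- (con 1ℚ :+ A) :* r)
                      := (con 1ℚ :- r) :* (P :- (con 1ℚ :- A :* r)) :+ A :* r :* r)
           refl r A ((1ℚ - r) ^ℚ a))

⌈n/2⌉+⌈n/2⌉≤1+n : ∀ n → ⌈ n /2⌉ ℕ.+ ⌈ n /2⌉ ℕ.≤ suc n
⌈n/2⌉+⌈n/2⌉≤1+n n = ℕ.≤-trans (ℕ.+-monoʳ-≤ ⌈ n /2⌉ (ℕ.⌊n/2⌋≤⌈n/2⌉ (suc n)))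
                               (ℕ.≤-reflexive (ℕ.⌊n/2⌋+⌈n/2⌉≡n (suc n)))

module _ (k : ℕ) .{{_ : NonZero k}} where

  K 1/k 1-1/k : ℚ
  K = ℕtoℚ k
  1/k = + 1 / k
  1-1/k = 1ℚ - 1/k

  0≤1/k : 0ℚ ≤ 1/k
  0≤1/k = ℚ.nonNegative⁻¹ 1/k {{ℚ.normalize-nonNeg 1 k}}

  1/k≤1 : 1/k ≤ 1ℚ
  1/k≤1 = subst₂ _≤_ (ℚ.*-identityˡ 1/k) (ℕtoℚ-*-inverseʳ k)
    (ℚ.*-monoʳ-≤-nonNeg 1/k {{nonNegative 0≤1/k}} (ℕtoℚ-mono-≤ (ℕ.>-nonZero⁻¹ k)))

  0≤1-1/k : 0ℚ ≤ 1-1/k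
  0≤1-1/k = p≤q⇒0≤q-p 1/k≤1

  divide-by-k : ∀ {p q} → p ≤ K * q → 1/k * p ≤ q
  divide-by-k {p} {q} p≤Kq =
    subst (1/k * p ≤_) 1/k*[K*q]≡q (ℚ.*-monoˡ-≤-nonNeg 1/k {{nonNegative 0≤1/k}} p≤Kq)
    where
    1/k*[K*q]≡q : 1/k * (K * q) ≡ q
    1/k*[K*q]≡q = trans (sym (ℚ.*-assoc 1/k K q))
      (trans (cong (_* q) (trans (ℚ.*-comm 1/k K) (ℕtoℚ-*-inverseʳ k))) (ℚ.*-identityˡ q))

  ½≤[1-1/k]^ : ∀ a → a ℕ.+ a ℕ.≤ k → + 1 / 2 ≤ 1-1/k ^ℚ a
  ½≤[1-1/k]^ a 2a≤k = ℚ.≤-trans ½≤1-a/k (bernoulli 0≤1/k 1/k≤1 a)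
    where
    A : ℚ
    A = ℕtoℚ a
    [A+A]/k≤1 : 1/k * (A + A) ≤ 1ℚ
    [A+A]/k≤1 = divide-by-k (subst₂ _≤_ (ℕtoℚ-+ a a) (sym (ℚ.*-identityʳ K)) (ℕtoℚ-mono-≤ 2a≤k))
    ½≤1-a/k : + 1 / 2 ≤ 1ℚ - A * 1/k
    ½≤1-a/k = ≤-by-nonNeg-difference
      (solve 2 (λ r A → (con 1ℚ :- A :* r) :- con (+ 1 / 2) := con (+ 1 / 2) :* (con 1ℚ :- r :* (A :+ A))) refl 1/k A)
      (*-pres-0≤ (ℚ.nonNegative⁻¹ (+ 1 / 2)) (p≤q⇒0≤q-p [A+A]/k≤1))

  ¼≤[1-1/k]^[k-1] : + 1 / 4 ≤ 1-1/k ^ℚ ℕ.pred k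
  ¼≤[1-1/k]^[k-1] =
    subst (+ 1 / 4 ≤_) (trans (sym (^ℚ-+ 1-1/k a b)) (cong (1-1/k ^ℚ_) (ℕ.⌊n/2⌋+⌈n/2⌉≡n j)))
    (≤-by-nonNeg-difference
      (solve 2 (λ X Y → X :* Y :- con (+ 1 / 4) := (X :- con (+ 1 / 2)) :* Y :+ con (+ 1 / 2) :* (Y :- con (+ 1 / 2)))
             refl (1-1/k ^ℚ a) (1-1/k ^ℚ b))
      (+-pres-0≤ (*-pres-0≤ (p≤q⇒0≤q-p ½≤xᵃ) (ℚ.≤-trans (ℚ.nonNegative⁻¹ (+ 1 / 2)) ½≤xᵇ))
                 (*-pres-0≤ (ℚ.nonNegative⁻¹ (+ 1 / 2)) (p≤q⇒0≤q-p ½≤xᵇ))))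
    where
    j a b : ℕ
    j = ℕ.pred k
    a = ⌊ j /2⌋
    b = ⌈ j /2⌉
    2b≤k : b ℕ.+ b ℕ.≤ k
    2b≤k = subst (b ℕ.+ b ℕ.≤_) (ℕ.suc-pred k) (⌈n/2⌉+⌈n/2⌉≤1+n j)
    ½≤xᵃ : + 1 / 2 ≤ 1-1/k ^ℚ a
    ½≤xᵃ = ½≤[1-1/k]^ a (ℕ.≤-trans (ℕ.+-mono-≤ (ℕ.⌊n/2⌋≤⌈n/2⌉ j) (ℕ.⌊n/2⌋≤⌈n/2⌉ j)) 2b≤k)
    ½≤xᵇ : + 1 / 2 ≤ 1-1/k ^ℚ b
    ½≤xᵇ = ½≤[1-1/k]^ b 2b≤k

  gap-contraction : ∀ {O g g′} → O + K * g ≤ g + K * g′ → O - g′ ≤ 1-1/k * (O - g)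
  gap-contraction {O} {g} {g′} greedy-step = ≤-by-nonNeg-difference
    (solve 4 (λ r O g g′ → (con 1ℚ :- r) :* (O :- g) :- (O :- g′) := (g′ :- g) :- r :* (O :- g)) refl 1/k O g g′)
    (p≤q⇒0≤q-p (divide-by-k (≤-by-nonNeg-difference
      (solve 4 (λ K O g g′ → K :* (g′ :- g) :- (O :- g) := (g :+ K :* g′) :- (O :+ K :* g)) refl K O g g′)
      (p≤q⇒0≤q-p greedy-step))))

  first-gap-bound : ∀ {O g f ε} → O + g ≤ f + K * g → O ≤ K * g → f ≤ (1/k - ε) * O →
                    O - g ≤ 1-1/k * O - 1/k * (ε * O)
  first-gap-bound {O} {g} {f} {ε} O+g≤f+Kg O≤Kg f≤[1/k-ε]O = ≤-by-nonNeg-difference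
    (solve 5 (λ r O g f ε → ((con 1ℚ :- r) :* O :- r :* (ε :* O)) :- (O :- g)
                          := (g :- r :* ((O :+ g) :- f)) :+ (r :* ((r :- ε) :* O :- f) :+ r :* (g :- r :* O)))
           refl 1/k O g f ε)
    (+-pres-0≤ (p≤q⇒0≤q-p (divide-by-k O+g-f≤Kg))
      (+-pres-0≤ (*-pres-0≤ 0≤1/k (p≤q⇒0≤q-p f≤[1/k-ε]O)) (*-pres-0≤ 0≤1/k (p≤q⇒0≤q-p (divide-by-k O≤Kg)))))
    where
    O+g-f≤Kg : (O + g) - f ≤ K * g
    O+g-f≤Kg = ≤-by-nonNeg-difference
      (solve 4 (λ K O g f → K :* g :- ((O :+ g) :- f) := (f :+ K :* g) :- (O :+ g)) refl K O g f)
      (p≤q⇒0≤q-p O+g≤f+Kg)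

  approximation-bound : ∀ {O g₁ gₖ ε P} → 0ℚ ≤ ε → 0ℚ ≤ O → O - gₖ ≤ P * (O - g₁) →
                        O - g₁ ≤ 1-1/k * O - 1/k * (ε * O) → + 1 / 8 ≤ P →
                        ((1ℚ - 1-1/k * P) + ε * (+ 1 / 8) * 1/k) * O ≤ gₖ
  approximation-bound {O} {g₁} {gₖ} {ε} {P} 0≤ε 0≤O decay first ⅛≤P = ≤-by-nonNeg-difference
    (solve 6 (λ r O g₁ gₖ ε P → gₖ :- ((con 1ℚ :- (con 1ℚ :- r) :* P) :+ ε :* con (+ 1 / 8) :* r) :* O
                               := (P :* (O :- g₁) :- (O :- gₖ))
                                  :+ (P :* (((con 1ℚ :- r) :* O :- r :* (ε :* O)) :- (O :- g₁))
                                  :+ (r :* (ε :* O)) :* (P :- con (+ 1 / 8))))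
           refl 1/k O g₁ gₖ ε P)
    (+-pres-0≤ (p≤q⇒0≤q-p decay)
      (+-pres-0≤ (*-pres-0≤ 0≤P (p≤q⇒0≤q-p first))
                 (*-pres-0≤ (*-pres-0≤ 0≤1/k (*-pres-0≤ 0≤ε 0≤O)) (p≤q⇒0≤q-p ⅛≤P))))
    where
    0≤P : 0ℚ ≤ P
    0≤P = ℚ.≤-trans (ℚ.nonNegative⁻¹ (+ 1 / 8)) ⅛≤P

  module _ {n m} (F : Family n m) (Os : List (Fin m)) (|Os|≡k : length Os ≡ k) where

    private
      O : ℚ
      O = ℕtoℚ (val F Os)

    greedy-gap-contraction : ∀ {C t} → IsGreedyChoice F C t →
                             O - ℕtoℚ (val F (C ++ [ t ])) ≤ 1-1/k * (O - ℕtoℚ (val F C))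
    greedy-gap-contraction {C} {t} greedy =
      gap-contraction {O} {ℕtoℚ (val F C)} {ℕtoℚ (val F (C ++ [ t ]))}
        (ℕtoℚ-mono-≤-+* (val F Os) k (val F C) (val F C) (val F (C ++ [ t ]))
          (subst (λ l → val F Os ℕ.+ l ℕ.* val F C ℕ.≤ val F C ℕ.+ l ℕ.* val F (C ++ [ t ]))
                 |Os|≡k (greedy-step-bound F greedy Os)))

    gap-decay : ∀ {L t ts} → GreedyRun F L → L ≡ t ∷ ts →
                O - ℕtoℚ (val F L) ≤ 1-1/k ^ℚ length ts * (O - ℕtoℚ (val F [ t ]))
    gap-decay (step {[]} _ _ _) refl = ℚ.≤-reflexive (sym (ℚ.*-identityˡ _))
    gap-decay (step {t ∷ ts} {u} run _ greedy) refl = begin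
      O - ℕtoℚ (val F (t ∷ ts ++ [ u ]))        ≤⟨ greedy-gap-contraction greedy ⟩
      x * (O - ℕtoℚ (val F (t ∷ ts)))            ≤⟨ ℚ.*-monoˡ-≤-nonNeg x {{nonNegative (0≤1-1/k)}} (gap-decay run refl) ⟩
      x * (x ^ℚ length ts * d)                    ≡⟨ ℚ.*-assoc x _ d ⟨
      x ^ℚ suc (length ts) * d                    ≡⟨ cong (λ l → x ^ℚ l * d) (trans (length-++ ts) (ℕ.+-comm (length ts) 1)) ⟨
      x ^ℚ length (ts ++ [ u ]) * d               ∎
      where
      open ℚ.≤-Reasoning
      x d : ℚ
      x = 1-1/k
      d = O - ℕtoℚ (val F [ t ])

    greedy-first-gap : ∀ {L t ts i ε} → GreedyRun F L → L ≡ t ∷ ts → i ∈ Os →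
                       ℕtoℚ ∣ F i ∣ ≤ (1/k - ε) * O →
                       O - ℕtoℚ (val F [ t ]) ≤ 1-1/k * O - 1/k * (ε * O)
    greedy-first-gap {t = t} {i = i} run refl i∈Os small-i = first-gap-bound O+g≤f+Kg O≤Kg small-i
      where
      g : ℕ
      g = val F [ t ]
      first-choice-maximal : ∀ u → ∣ F u ∣ ℕ.≤ g
      first-choice-maximal = greedy-first-choice-maximal F run refl
      O+g≤f+Kg : O + ℕtoℚ g ≤ ℕtoℚ ∣ F i ∣ + K * ℕtoℚ g
      O+g≤f+Kg = subst₂ _≤_ (ℕtoℚ-+ (val F Os) g)
        (trans (ℕtoℚ-+ ∣ F i ∣ (k ℕ.* g)) (cong (λ z → ℕtoℚ ∣ F i ∣ + z) (ℕtoℚ-* k g)))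
        (ℕtoℚ-mono-≤ (subst (λ l → val F Os ℕ.+ g ℕ.≤ ∣ F i ∣ ℕ.+ l ℕ.* g) |Os|≡k
          (val+max≤∣F∣+length*max F first-choice-maximal i∈Os)))
      O≤Kg : O ≤ K * ℕtoℚ g
      O≤Kg = subst (O ≤_) (ℕtoℚ-* k g)
        (ℕtoℚ-mono-≤ (subst (λ l → val F Os ℕ.≤ l ℕ.* g) |Os|≡k (val≤length*max F first-choice-maximal Os)))

lemma7 : ∀ (n m k : ℕ) .{{_ : NonZero k}} → k ℕ.≤ m → (F : Family n m)
         → (S Sopt : List (Fin m))
         → IsGreedyOutput F k S → IsOptimal F k Sopt
         → (ε : ℚ) → 0ℚ < ε
         → (∃[ i ] (i ∈ Sopt × ℕtoℚ ∣ F i ∣ < ((+ 1 / k) - ε) * ℕtoℚ (val F Sopt)))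
         → ((1ℚ - (1ℚ - (+ 1 / k)) ^ℚ k) + (ε * (+ 1 / 8) * (+ 1 / k))) * ℕtoℚ (val F Sopt)
           ≤ ℕtoℚ (val F S)
lemma7 _ _ k _ _ [] _ (_ , _ , |S|≡k) _ _ _ _ = ⊥-elim (ℕ.≢-nonZero⁻¹ k (sym |S|≡k))
lemma7 _ _ k _ F (t ∷ ts) Sopt (run , _ , refl) ((_ , |Sopt|≡k) , _) ε 0<ε (i , i∈Sopt , small-i) =
  approximation-bound k (ℚ.<⇒≤ 0<ε) (ℕtoℚ-mono-≤ {b = val F Sopt} z≤n)
    (gap-decay k F Sopt |Sopt|≡k run refl)
    (greedy-first-gap k F Sopt |Sopt|≡k run refl i∈Sopt (ℚ.<⇒≤ small-i))
    (ℚ.≤-trans (ℚ.≤ᵇ⇒≤ _) (¼≤[1-1/k]^[k-1] k))
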